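{- Let $n$ be a nonnegative integer, let $q$ be an odd prime, and let $r$ be a nonnegative integer. Suppose $q^2 = a^2 + nb^2$ for some positive integers $a, b$ (both nonzero). (i) If $q^2 r = x^2 + ny^2$ for some nonnegative integers $x, y$, then $r = u^2 + nv^2$ for some nonnegative integers $u, v$. (ii) If moreover $q^2 r = x^2 + ny^2$ with $x, y$ both nonzero and $\gcd(x,y) = 1$, and $r \neq 1$ and $r \neq n$, then $r = u^2 + nv^2$ for some nonzero nonnegative integers $u, v$ with $\gcd(u,v) = 1$.
   Context: A $(1,n)$-representation of a nonnegative integer $m$ is an expression $m = x^2 + ny^2$ with $x,y$ nonnegative integers; it is nontrivial if $x$ and $y$ are both nonzero, and proper if $\gcd(x,y)=1$. -}

module Defs where

open import Data.Nat using (ℕ; _+_; _*_; _^_)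
open import Data.Nat.GCD using (gcd)
open import Data.Product using (Σ; _×_)
open import Relation.Binary.PropositionalEquality using (_≡_; _≢_)

IsRep : ℕ → ℕ → ℕ → ℕ → Set
IsRep n m x y = m ≡ x ^ 2 + n * y ^ 2

HasRep : ℕ → ℕ → Set
HasRep n m = Σ ℕ λ x → Σ ℕ λ y → IsRep n m x y

Nontrivial : ℕ → ℕ → Set
Nontrivial x y = x ≢ 0 × y ≢ 0

Proper : ℕ → ℕ → Set
Proper x y = gcd x y ≡ 1

HasNontrivProperRep : ℕ → ℕ → Set
HasNontrivProperRep n m =
  Σ ℕ λ x → Σ ℕ λ y → IsRep n m x y × Nontrivial x y × Proper x y

{-# OPTIONS --safe #-}
-- Put α = a + b√−n and ξ = x + y√−n, so that q² = αᾱ and q²r = ξξ̄. As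
-- ξᾱ = (ax + nby) + (ay − bx)√−n, α divides ξ exactly when q² divides both coordinates;
-- the second suffices, because a(ax + nby) = q²x + nb(ay − bx) and q ∤ a (as 0 < a < q).
-- Then ξ/α = u + v√−n has norm r, and x, y are integral combinations of u, v.
-- Since (ay − bx)(ay + bx) = q²(y² − b²r), q² divides ay − bx, or ay + bx (replace b by −b),
-- unless q divides both: then q ∣ 2ay, so q ∣ y, hence q ∣ x and (x/q, y/q) represents r.
-- In every case gcd(u, v) ∣ gcd(x, y); for (ii) it is therefore 1, and u = 0 or v = 0
-- would force r = n or r = 1. When n = 0 simply q ∣ x and r = (x/q)².
module Submission where

open import Defs
open import Data.Nat.Base using (ℕ)
open import Data.Nat.GCD
  using (gcd; gcd[m,n]∣m; gcd[m,n]∣n; gcd-greatest; gcd-identityˡ; gcd-identityʳ)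
open import Data.Nat.Primality using (Prime; euclidsLemma; prime⇒nonZero; ¬prime[1]; irreducible[2])
open import Data.Product using (Σ; _×_; _,_)
open import Data.Sum using (_⊎_; inj₁; inj₂)
open import Data.List using (_∷_; [])
open import Function using (case_of_)
open import Relation.Nullary using (yes; no; contradiction)
open import Relation.Binary.PropositionalEquality
  using (_≡_; _≢_; refl; sym; trans; cong; cong₂; subst; subst₂; module ≡-Reasoning)

module Natural where
  open import Data.Nat using (_+_; _*_; _^_; NonZero; ≢-nonZero)
  open import Data.Nat.Properties
  open import Data.Nat.Divisibility
  open import Data.Nat.Tactic.RingSolver using (solve)

  m^2≡m*m : ∀ m → m ^ 2 ≡ m * m
  m^2≡m*m m = cong (m *_) (*-identityʳ m)

  m∣m^2*n : ∀ m n → m ∣ m ^ 2 * n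
  m∣m^2*n m n = ∣m⇒∣m*n n (m∣m*n (m ^ 1))

  p∤m⇒p∣m*n⇒p∣n : ∀ {p m n} → Prime p → p ∤ m → p ∣ m * n → p ∣ n
  p∤m⇒p∣m*n⇒p∣n {m = m} {n} p-prime p∤m p∣mn with euclidsLemma m n p-prime p∣mn
  ... | inj₁ p∣m = contradiction p∣m p∤m
  ... | inj₂ p∣n = p∣n

  p∣m^2⇒p∣m : ∀ {p m} → Prime p → p ∣ m ^ 2 → p ∣ m
  p∣m^2⇒p∣m {p} {m} p-prime p∣m²
    with euclidsLemma m m p-prime (subst (p ∣_) (m^2≡m*m m) p∣m²)
  ... | inj₁ p∣m = p∣m
  ... | inj₂ p∣m = p∣m

  p∤m⇒p²∣m*n⇒p²∣n : ∀ {p m n} → Prime p → p ∤ m → p ^ 2 ∣ m * n → p ^ 2 ∣ n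
  p∤m⇒p²∣m*n⇒p²∣n {p} {m} p-prime p∤m p²∣mn
    with p∤m⇒p∣m*n⇒p∣n p-prime p∤m (∣-trans (m∣m*n (p ^ 1)) p²∣mn)
  ... | divides c refl = subst (_∣ c * p) (sym (m^2≡m*m p)) (*-monoˡ-∣ p p∣c)
    where
    instance _ = prime⇒nonZero p-prime
    p∣c : p ∣ c
    p∣c = p∤m⇒p∣m*n⇒p∣n p-prime p∤m
            (*-cancelʳ-∣ p (subst₂ _∣_ (m^2≡m*m p) (sym (*-assoc m c p)) p²∣mn))

  p²∣m*n⇒p∣m×p∣n⊎p²∣m⊎p²∣n : ∀ {p m n} → Prime p → p ^ 2 ∣ m * n →
    (p ∣ m × p ∣ n) ⊎ p ^ 2 ∣ m ⊎ p ^ 2 ∣ n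
  p²∣m*n⇒p∣m×p∣n⊎p²∣m⊎p²∣n {p} {m} {n} p-prime p²∣mn with p ∣? m | p ∣? n
  ... | no p∤m  | _       = inj₂ (inj₂ (p∤m⇒p²∣m*n⇒p²∣n p-prime p∤m p²∣mn))
  ... | yes _   | no p∤n  =
    inj₂ (inj₁ (p∤m⇒p²∣m*n⇒p²∣n p-prime p∤n (subst (p ^ 2 ∣_) (*-comm m n) p²∣mn)))
  ... | yes p∣m | yes p∣n = inj₁ (p∣m , p∣n)

  p≢2⇒p∤2 : ∀ {p} → Prime p → p ≢ 2 → p ∤ 2
  p≢2⇒p∤2 p-prime p≢2 p∣2 with irreducible[2] p∣2
  ... | inj₁ refl = ¬prime[1] p-prime
  ... | inj₂ p≡2  = p≢2 p≡2

  q²≡a²+nb²⇒q∤a : ∀ {q a n b} → a ≢ 0 → n ≢ 0 → b ≢ 0 →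
    q ^ 2 ≡ a ^ 2 + n * b ^ 2 → q ∤ a
  q²≡a²+nb²⇒q∤a {q} {a} {n} {b} a≢0 n≢0 b≢0 q²≡a²+nb² q∣a =
    <-irrefl refl (begin-strict
      a ^ 2              <⟨ m<m+n (a ^ 2) (n≢0⇒n>0 nb²≢0) ⟩
      a ^ 2 + n * b ^ 2  ≡⟨ q²≡a²+nb² ⟨
      q ^ 2              ≤⟨ ^-monoˡ-≤ 2 (∣⇒≤ ⦃ ≢-nonZero a≢0 ⦄ q∣a) ⟩
      a ^ 2              ∎)
    where
    open ≤-Reasoning
    nb²≢0 : n * b ^ 2 ≢ 0
    nb²≢0 nb²≡0 with m*n≡0⇒m≡0∨n≡0 n nb²≡0
    ... | inj₁ n≡0  = n≢0 n≡0
    ... | inj₂ b²≡0 = b≢0 (m^n≡0⇒m≡0 b 2 b²≡0)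

  gcd-mono-∣ : ∀ {u v x y} → u ∣ x → v ∣ y → gcd u v ∣ gcd x y
  gcd-mono-∣ {u} {v} u∣x v∣y =
    gcd-greatest (∣-trans (gcd[m,n]∣m u v) u∣x) (∣-trans (gcd[m,n]∣n u v) v∣y)

  -- The chain writes k ^ 2 in its unfolded form k * (k * 1): the ring solver cannot read _^_.
  IsRep-cancel : ∀ n {q r} u v .⦃ _ : NonZero q ⦄ →
    IsRep n (q ^ 2 * r) (u * q) (v * q) → IsRep n r u v
  IsRep-cancel n {q} {r} u v rep = *-cancelˡ-≡ r _ (q ^ 2) ⦃ m^n≢0 q 2 ⦄ (begin
    q ^ 2 * r                                          ≡⟨ rep ⟩
    u * q * (u * q * 1) + n * (v * q * (v * q * 1))    ≡⟨ solve (n ∷ q ∷ u ∷ v ∷ []) ⟩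
    q * (q * 1) * (u * (u * 1) + n * (v * (v * 1)))    ∎)
    where
    open ≡-Reasoning

  p∣y⇒p∣x : ∀ n x y {p m} → Prime p → p ∣ m → IsRep n m x y → p ∣ y → p ∣ x
  p∣y⇒p∣x n x y {p} p-prime p∣m rep p∣y =
    p∣m^2⇒p∣m p-prime (∣m+n∣m⇒∣n (subst (p ∣_) (trans rep (+-comm (x ^ 2) _)) p∣m) p∣ny²)
    where
    p∣ny² : p ∣ n * y ^ 2
    p∣ny² = ∣n⇒∣m*n n (∣m⇒∣m*n (y ^ 1) p∣y)

  HasRepWithGcd∣ : ℕ → ℕ → ℕ → Set
  HasRepWithGcd∣ n m g = Σ ℕ λ u → Σ ℕ λ v → IsRep n m u v × gcd u v ∣ g

  scaled-descent : ∀ n x y {q r} → Prime q → IsRep n (q ^ 2 * r) x y → q ∣ y →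
    HasRepWithGcd∣ n r (gcd x y)
  scaled-descent n x y {q} {r} q-prime rep q∣y@(divides d refl)
    with p∣y⇒p∣x n x (d * q) q-prime (m∣m^2*n q r) rep q∣y
  ... | divides c refl =
    c , d , IsRep-cancel n c d ⦃ prime⇒nonZero q-prime ⦄ rep ,
    gcd-mono-∣ {c} {d} (m∣m*n q) (m∣m*n q)

  -- IsRep 0 m x y unfolds to m ≡ x ^ 2 + 0 whatever y is, so rep also serves with y replaced by 0.
  degenerate-descent : ∀ x y {q r} → Prime q → IsRep 0 (q ^ 2 * r) x y →
    HasRepWithGcd∣ 0 r (gcd x y)
  degenerate-descent x y {q} {r} q-prime rep
    with p∣y⇒p∣x 0 x 0 q-prime (m∣m^2*n q r) rep (q ∣0)
  ... | divides c refl =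
    c , y , IsRep-cancel 0 c y ⦃ prime⇒nonZero q-prime ⦄ rep ,
    gcd-mono-∣ {c} {y} (m∣m*n q) ∣-refl

  HasRepWithGcd∣1⇒HasNontrivProperRep : ∀ {n r} → r ≢ 1 → r ≢ n →
    HasRepWithGcd∣ n r 1 → HasNontrivProperRep n r
  HasRepWithGcd∣1⇒HasNontrivProperRep {n} {r} r≢1 r≢n (u , v , rep , g∣1) =
    u , v , rep , (u≢0 , v≢0) , gcd≡1
    where
    open ≡-Reasoning
    gcd≡1 : gcd u v ≡ 1
    gcd≡1 = ∣1⇒≡1 g∣1
    u≢0 : u ≢ 0
    u≢0 refl = r≢n (begin
      r            ≡⟨ rep ⟩
      n * v ^ 2    ≡⟨ cong (λ t → n * t ^ 2) v≡1 ⟩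
      n * 1        ≡⟨ *-identityʳ n ⟩
      n            ∎)
      where
      v≡1 : v ≡ 1
      v≡1 = trans (sym (gcd-identityˡ v)) gcd≡1
    v≢0 : v ≢ 0
    v≢0 refl = r≢1 (begin
      r              ≡⟨ rep ⟩
      u ^ 2 + n * 0  ≡⟨ cong₂ (λ s t → s ^ 2 + t) u≡1 (*-zeroʳ n) ⟩
      1              ∎)
      where
      u≡1 : u ≡ 1
      u≡1 = trans (sym (gcd-identityʳ u)) gcd≡1
open Natural

module Integral where
  import Data.Nat as ℕ
  open import Data.Nat.Divisibility using () renaming (_∣_ to _∣ℕ_; _∤_ to _∤ℕ_)
  open import Data.Integer using (ℤ; +_; -[1+_]; -_; _+_; _-_; _*_; ∣_∣; NonZero)
  open import Data.Integer.Properties using (pos-+; pos-*; +-injective; abs-*; *-cancelˡ-≡)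
  open import Data.Integer.Divisibility.Signed
    using (_∣_; divides; ∣ᵤ⇒∣; ∣⇒∣ᵤ; ∣-refl; ∣m∣n⇒∣m+n; ∣m∣n⇒∣m-n; ∣m⇒∣m*n; ∣n⇒∣m*n)
  open import Data.Integer.Tactic.RingSolver using (solve; solve-∀)
  open import Data.Nat.Properties using (m^n≢0)
  open ≡-Reasoning

  -i*-i≡i*i : ∀ i → - i * - i ≡ i * i
  -i*-i≡i*i = solve-∀

  +∣i∣*+∣i∣≡i*i : ∀ i → + ∣ i ∣ * + ∣ i ∣ ≡ i * i
  +∣i∣*+∣i∣≡i*i (+ _)    = refl
  +∣i∣*+∣i∣≡i*i -[1+ _ ] = refl

  IsRep⇒ℤ : ∀ n x y {m} → IsRep n m x y → + m ≡ + x * + x + + n * (+ y * + y)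
  IsRep⇒ℤ n x y {m} rep = begin
    + m                                   ≡⟨ cong +_ rep ⟩
    + (x ℕ.^ 2 ℕ.+ n ℕ.* y ℕ.^ 2)         ≡⟨ pos-+ (x ℕ.^ 2) _ ⟩
    + (x ℕ.^ 2) + + (n ℕ.* y ℕ.^ 2)       ≡⟨ cong₂ _+_ (pos-^2 x) (pos-* n _) ⟩
    + x * + x + + n * + (y ℕ.^ 2)         ≡⟨ cong (λ t → + x * + x + + n * t) (pos-^2 y) ⟩
    + x * + x + + n * (+ y * + y)         ∎
    where
    pos-^2 : ∀ k → + (k ℕ.^ 2) ≡ + k * + k
    pos-^2 k = trans (cong +_ (m^2≡m*m k)) (pos-* k k)

  ℤ⇒IsRep : ∀ n U V {m} → + m ≡ U * U + + n * (V * V) → IsRep n m ∣ U ∣ ∣ V ∣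
  ℤ⇒IsRep n U V {m} eq = +-injective (begin
    + m                                            ≡⟨ eq ⟩
    U * U + + n * (V * V)                          ≡⟨ cong₂ (λ s t → s + + n * t) U² V² ⟨
    + ∣ U ∣ * + ∣ U ∣ + + n * (+ ∣ V ∣ * + ∣ V ∣)  ≡⟨ IsRep⇒ℤ n ∣ U ∣ ∣ V ∣ refl ⟨
    + (∣ U ∣ ℕ.^ 2 ℕ.+ n ℕ.* ∣ V ∣ ℕ.^ 2)          ∎)
    where
    U² : + ∣ U ∣ * + ∣ U ∣ ≡ U * U
    U² = +∣i∣*+∣i∣≡i*i U
    V² : + ∣ V ∣ * + ∣ V ∣ ≡ V * V
    V² = +∣i∣*+∣i∣≡i*i V

  brahmagupta : ∀ N A B U V →
    (A * A + N * (B * B)) * (U * U + N * (V * V))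
      ≡ (A * U - N * B * V) * (A * U - N * B * V) + N * ((A * V + B * U) * (A * V + B * U))
  brahmagupta = solve-∀

  Q∣[AY-BX][AY+BX] : ∀ N A B X Y {Q R} →
    A * A + N * (B * B) ≡ Q → X * X + N * (Y * Y) ≡ Q * R →
    Q ∣ (A * Y - B * X) * (A * Y + B * X)
  Q∣[AY-BX][AY+BX] N A B X Y {Q} {R} A²+NB²≡Q X²+NY²≡QR = divides (Y * Y - B * B * R) (begin
    (A * Y - B * X) * (A * Y + B * X)
      ≡⟨ solve (N ∷ A ∷ B ∷ X ∷ Y ∷ []) ⟩
    (A * A + N * (B * B)) * (Y * Y) - B * B * (X * X + N * (Y * Y))
      ≡⟨ cong₂ (λ s t → s * (Y * Y) - B * B * t) A²+NB²≡Q X²+NY²≡QR ⟩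
    Q * (Y * Y) - B * B * (Q * R)
      ≡⟨ solve (B ∷ Y ∷ Q ∷ R ∷ []) ⟩
    (Y * Y - B * B * R) * Q
      ∎)

  Q∣AY-BX⇒Q∣A[AX+NBY] : ∀ N A B X Y {Q} → A * A + N * (B * B) ≡ Q →
    Q ∣ A * Y - B * X → Q ∣ A * (A * X + N * B * Y)
  Q∣AY-BX⇒Q∣A[AX+NBY] N A B X Y {Q} A²+NB²≡Q Q∣D =
    subst (Q ∣_) AP≡QX+NBD (∣m∣n⇒∣m+n (∣m⇒∣m*n X ∣-refl) (∣n⇒∣m*n (N * B) Q∣D))
    where
    AP≡QX+NBD : Q * X + N * B * (A * Y - B * X) ≡ A * (A * X + N * B * Y)
    AP≡QX+NBD = begin
      Q * X + N * B * (A * Y - B * X)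
        ≡⟨ cong (λ s → s * X + N * B * (A * Y - B * X)) A²+NB²≡Q ⟨
      (A * A + N * (B * B)) * X + N * B * (A * Y - B * X)  ≡⟨ solve (N ∷ A ∷ B ∷ X ∷ Y ∷ []) ⟩
      A * (A * X + N * B * Y)                              ∎

  rep-quotient : ∀ N A B X Y {Q R} .⦃ _ : NonZero Q ⦄ →
    A * A + N * (B * B) ≡ Q → X * X + N * (Y * Y) ≡ Q * R →
    Q ∣ A * X + N * B * Y → Q ∣ A * Y - B * X →
    Σ ℤ λ U → Σ ℤ λ V → R ≡ U * U + N * (V * V) × X ≡ A * U - N * B * V × Y ≡ A * V + B * U
  rep-quotient N A B X Y {Q} {R} A²+NB²≡Q X²+NY²≡QR (divides U P≡UQ) (divides V D≡VQ) =
    U , V , R≡U²+NV² , X≡AU-NBV , Y≡AV+BU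
    where
    X≡AU-NBV : X ≡ A * U - N * B * V
    X≡AU-NBV = *-cancelˡ-≡ Q _ _ (begin
      Q * X                                              ≡⟨ cong (_* X) A²+NB²≡Q ⟨
      (A * A + N * (B * B)) * X                          ≡⟨ solve (N ∷ A ∷ B ∷ X ∷ Y ∷ []) ⟩
      A * (A * X + N * B * Y) - N * B * (A * Y - B * X)  ≡⟨ cong₂ (λ p d → A * p - N * B * d) P≡UQ D≡VQ ⟩
      A * (U * Q) - N * B * (V * Q)                      ≡⟨ solve (N ∷ A ∷ B ∷ U ∷ V ∷ Q ∷ []) ⟩
      Q * (A * U - N * B * V)                            ∎)
    Y≡AV+BU : Y ≡ A * V + B * U
    Y≡AV+BU = *-cancelˡ-≡ Q _ _ (begin
      Q * Y                                      ≡⟨ cong (_* Y) A²+NB²≡Q ⟨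
      (A * A + N * (B * B)) * Y                  ≡⟨ solve (N ∷ A ∷ B ∷ X ∷ Y ∷ []) ⟩
      A * (A * Y - B * X) + B * (A * X + N * B * Y)  ≡⟨ cong₂ (λ d p → A * d + B * p) D≡VQ P≡UQ ⟩
      A * (V * Q) + B * (U * Q)                  ≡⟨ solve (A ∷ B ∷ U ∷ V ∷ Q ∷ []) ⟩
      Q * (A * V + B * U)                        ∎)
    R≡U²+NV² : R ≡ U * U + N * (V * V)
    R≡U²+NV² = *-cancelˡ-≡ Q _ _ (begin
      Q * R                                  ≡⟨ X²+NY²≡QR ⟨
      X * X + N * (Y * Y)                    ≡⟨ cong₂ (λ x y → x * x + N * (y * y)) X≡AU-NBV Y≡AV+BU ⟩
      (A * U - N * B * V) * (A * U - N * B * V) + N * ((A * V + B * U) * (A * V + B * U))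
                                             ≡⟨ brahmagupta N A B U V ⟨
      (A * A + N * (B * B)) * (U * U + N * (V * V))  ≡⟨ cong (_* _) A²+NB²≡Q ⟩
      Q * (U * U + N * (V * V))              ∎)

  gcd[∣U∣,∣V∣]∣gcd[x,y] : ∀ A B N U V {x y} →
    + x ≡ A * U - N * B * V → + y ≡ A * V + B * U → gcd ∣ U ∣ ∣ V ∣ ∣ℕ gcd x y
  gcd[∣U∣,∣V∣]∣gcd[x,y] A B N U V {x} {y} x≡AU-NBV y≡AV+BU =
    gcd-greatest (∣⇒∣ᵤ g∣x) (∣⇒∣ᵤ g∣y)
    where
    g∣U : + (gcd ∣ U ∣ ∣ V ∣) ∣ U
    g∣U = ∣ᵤ⇒∣ (gcd[m,n]∣m ∣ U ∣ ∣ V ∣)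
    g∣V : + (gcd ∣ U ∣ ∣ V ∣) ∣ V
    g∣V = ∣ᵤ⇒∣ (gcd[m,n]∣n ∣ U ∣ ∣ V ∣)
    g∣x : + (gcd ∣ U ∣ ∣ V ∣) ∣ + x
    g∣x = subst (_ ∣_) (sym x≡AU-NBV) (∣m∣n⇒∣m-n (∣n⇒∣m*n A g∣U) (∣n⇒∣m*n (N * B) g∣V))
    g∣y : + (gcd ∣ U ∣ ∣ V ∣) ∣ + y
    g∣y = subst (_ ∣_) (sym y≡AV+BU) (∣m∣n⇒∣m+n (∣n⇒∣m*n A g∣V) (∣n⇒∣m*n B g∣U))

  descent-by : ∀ n a x y {q r} (B : ℤ) → Prime q → q ∤ℕ a →
    + a * + a + + n * (B * B) ≡ + (q ℕ.^ 2) → + x * + x + + n * (+ y * + y) ≡ + (q ℕ.^ 2) * + r →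
    q ℕ.^ 2 ∣ℕ ∣ + a * + y - B * + x ∣ → HasRepWithGcd∣ n r (gcd x y)
  descent-by n a x y {q} B q-prime q∤a A²+NB²≡Q X²+NY²≡QR Q∣ᵤD =
    case rep-quotient (+ n) (+ a) B (+ x) (+ y) ⦃ Q≢0 ⦄ A²+NB²≡Q X²+NY²≡QR Q∣P Q∣D of λ where
      (U , V , r≡U²+nV² , x≡aU-nBV , y≡aV+BU) →
        ∣ U ∣ , ∣ V ∣ , ℤ⇒IsRep n U V r≡U²+nV² ,
        gcd[∣U∣,∣V∣]∣gcd[x,y] (+ a) B (+ n) U V x≡aU-nBV y≡aV+BU
    where
    Q≢0 : NonZero (+ (q ℕ.^ 2))
    Q≢0 = m^n≢0 q 2 ⦃ prime⇒nonZero q-prime ⦄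
    Q∣D : + (q ℕ.^ 2) ∣ + a * + y - B * + x
    Q∣D = ∣ᵤ⇒∣ Q∣ᵤD
    Q∣aP : q ℕ.^ 2 ∣ℕ a ℕ.* ∣ + a * + x + + n * B * + y ∣
    Q∣aP = subst (q ℕ.^ 2 ∣ℕ_) (abs-* (+ a) _)
      (∣⇒∣ᵤ (Q∣AY-BX⇒Q∣A[AX+NBY] (+ n) (+ a) B (+ x) (+ y) A²+NB²≡Q Q∣D))
    Q∣P : + (q ℕ.^ 2) ∣ + a * + x + + n * B * + y
    Q∣P = ∣ᵤ⇒∣ (p∤m⇒p²∣m*n⇒p²∣n q-prime q∤a Q∣aP)

  coprime-descent : ∀ n a b x y {q r} → Prime q → q ≢ 2 → q ∤ℕ a →
    IsRep n (q ℕ.^ 2) a b → IsRep n (q ℕ.^ 2 ℕ.* r) x y → HasRepWithGcd∣ n r (gcd x y)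
  coprime-descent n a b x y {q} {r} q-prime q≢2 q∤a q²≡a²+nb² rep =
    case p²∣m*n⇒p∣m×p∣n⊎p²∣m⊎p²∣n q-prime Q∣D₋D₊ of λ where
      (inj₁ (q∣D₋ , q∣D₊)) → scaled-descent n x y q-prime rep (q∣y q∣D₋ q∣D₊)
      (inj₂ (inj₁ Q∣D₋))   → descent-by n a x y (+ b) q-prime q∤a A²+NB²≡Q X²+NY²≡QR Q∣D₋
      (inj₂ (inj₂ Q∣D₊))   → descent-by n a x y (- + b) q-prime q∤a A²+N[-B]²≡Q X²+NY²≡QR
                                (subst (λ d → q ℕ.^ 2 ∣ℕ ∣ d ∣) D₊≡AY-[-B]X Q∣D₊)
    where
    D₋ : ℤ
    D₋ = + a * + y - + b * + x
    D₊ : ℤ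
    D₊ = + a * + y + + b * + x
    A²+NB²≡Q : + a * + a + + n * (+ b * + b) ≡ + (q ℕ.^ 2)
    A²+NB²≡Q = sym (IsRep⇒ℤ n a b q²≡a²+nb²)
    A²+N[-B]²≡Q : + a * + a + + n * (- + b * - + b) ≡ + (q ℕ.^ 2)
    A²+N[-B]²≡Q = trans (cong (λ s → + a * + a + + n * s) (-i*-i≡i*i (+ b))) A²+NB²≡Q
    X²+NY²≡QR : + x * + x + + n * (+ y * + y) ≡ + (q ℕ.^ 2) * + r
    X²+NY²≡QR = trans (sym (IsRep⇒ℤ n x y rep)) (pos-* (q ℕ.^ 2) r)
    D₊≡AY-[-B]X : D₊ ≡ + a * + y - - + b * + x
    D₊≡AY-[-B]X = AY+BX≡AY-[-B]X (+ a) (+ b) (+ x) (+ y)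
      where
      AY+BX≡AY-[-B]X : ∀ A B X Y → A * Y + B * X ≡ A * Y - - B * X
      AY+BX≡AY-[-B]X = solve-∀
    Q∣D₋D₊ : q ℕ.^ 2 ∣ℕ ∣ D₋ ∣ ℕ.* ∣ D₊ ∣
    Q∣D₋D₊ = subst (q ℕ.^ 2 ∣ℕ_) (abs-* D₋ D₊)
      (∣⇒∣ᵤ (Q∣[AY-BX][AY+BX] (+ n) (+ a) (+ b) (+ x) (+ y) A²+NB²≡Q X²+NY²≡QR))
    q∣y : q ∣ℕ ∣ D₋ ∣ → q ∣ℕ ∣ D₊ ∣ → q ∣ℕ y
    q∣y q∣D₋ q∣D₊ =
      p∤m⇒p∣m*n⇒p∣n q-prime q∤a (p∤m⇒p∣m*n⇒p∣n q-prime (p≢2⇒p∤2 q-prime q≢2) q∣2ay)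
      where
      [AY-BX]+[AY+BX]≡2AY : ∀ A B X Y → (A * Y - B * X) + (A * Y + B * X) ≡ + 2 * (A * Y)
      [AY-BX]+[AY+BX]≡2AY = solve-∀
      D₋+D₊≡2ay : D₋ + D₊ ≡ + (2 ℕ.* (a ℕ.* y))
      D₋+D₊≡2ay = begin
        D₋ + D₊              ≡⟨ [AY-BX]+[AY+BX]≡2AY (+ a) (+ b) (+ x) (+ y) ⟩
        + 2 * (+ a * + y)    ≡⟨ cong (+ 2 *_) (pos-* a y) ⟨
        + 2 * + (a ℕ.* y)    ≡⟨ pos-* 2 (a ℕ.* y) ⟨
        + (2 ℕ.* (a ℕ.* y))  ∎
      q∣D₋+D₊ : + q ∣ D₋ + D₊
      q∣D₋+D₊ = ∣m∣n⇒∣m+n (∣ᵤ⇒∣ {+ q} {D₋} q∣D₋) (∣ᵤ⇒∣ {+ q} {D₊} q∣D₊)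
      q∣2ay : q ∣ℕ 2 ℕ.* (a ℕ.* y)
      q∣2ay = subst (λ s → q ∣ℕ ∣ s ∣) D₋+D₊≡2ay (∣⇒∣ᵤ q∣D₋+D₊)
open Integral

open import Data.Nat using (zero; suc; _+_; _*_; _^_)
open import Data.Nat.Divisibility using (_∤_)

descent : ∀ n a b x y {q r} → Prime q → q ≢ 2 → a ≢ 0 → b ≢ 0 →
  IsRep n (q ^ 2) a b → IsRep n (q ^ 2 * r) x y → HasRepWithGcd∣ n r (gcd x y)
descent zero      _ _ x y q-prime _   _   _   _ = degenerate-descent x y q-prime
descent n@(suc _) a b x y {q} q-prime q≢2 a≢0 b≢0 q²≡a²+nb² =
  coprime-descent n a b x y q-prime q≢2 q∤a q²≡a²+nb²
  where
  q∤a : q ∤ a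
  q∤a = q²≡a²+nb²⇒q∤a {n = n} a≢0 (λ ()) b≢0 q²≡a²+nb²

lemma2 : (n q r : ℕ) → Prime q → q ≢ 2 →
    (a b : ℕ) → a ≢ 0 → b ≢ 0 → q ^ 2 ≡ a ^ 2 + n * b ^ 2 →
      (HasRep n (q ^ 2 * r) → HasRep n r)
      × (HasNontrivProperRep n (q ^ 2 * r) → r ≢ 1 → r ≢ n → HasNontrivProperRep n r)
lemma2 n q r q-prime q≢2 a b a≢0 b≢0 q²≡a²+nb² =
    (λ (x , y , rep) → let (u , v , rep′ , _) = descent′ x y rep in u , v , rep′)
    -- part (ii) does not use the nontriviality of (x , y)
  , λ (x , y , rep , _ , gcd≡1) r≢1 r≢n →
      HasRepWithGcd∣1⇒HasNontrivProperRep r≢1 r≢n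
        (subst (HasRepWithGcd∣ n r) gcd≡1 (descent′ x y rep))
  where
  descent′ : ∀ x y → IsRep n (q ^ 2 * r) x y → HasRepWithGcd∣ n r (gcd x y)
  descent′ x y = descent n a b x y q-prime q≢2 a≢0 b≢0 q²≡a²+nb²
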